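{- For every agent $a$, every $\phi\in\Lambda$ and every $\psi\in\mathcal{L}_{ELKy^r}$, the formula $Ky_a^r(\psi,\phi)$ is a theorem of $\mathbb{SKYR}$; i.e., the rule "from $\phi\in\Lambda$ infer $\vdash Ky_a^r(\psi,\phi)$" is admissible in $\mathbb{SKYR}$.
   Context: $\mathcal{L}_{ELKy^r}$ is given by $\phi ::= p\mid\neg\phi\mid(\phi\land\phi)\mid K_a\phi\mid Ky_a^r(\phi,\phi)$ over a countably infinite set of atoms and a countable set of agents; $\to,\top,\bot$ as usual. $\Lambda\subseteq\mathcal{L}_{ELKy^r}$ is a fixed set (tautology ground). The Hilbert system $\mathbb{SKYR}$ has, for all agents $a$ and formulas: (PT) all classical propositional tautologies; (K) $K_a(\phi\to\psi)\to(K_a\phi\to K_a\psi)$; (T) $K_a\phi\to\phi$; (4) $K_a\phi\to K_aK_a\phi$; (5) $\neg K_a\phi\to K_a\neg K_a\phi$; (EKyR) $Ky_a^r(\chi,\phi\to\psi)\to(Ky_a^r(\theta,\phi)\to Ky_a^r(\chi\land\theta,\psi))$; (4YKR) $Ky_a^r(\phi,\psi)\to K_aKy_a^r(\phi,\psi)$; (DKyR) $Ky_a^r(\phi,\psi)\to K_a(\phi\to\psi)$; (IKyR) $Ky_a^r(\psi,\chi)\to(K_a(\phi\to\psi)\to Ky_a^r(\phi,\chi))$; (UKyR) $K_a\neg\phi\to Ky_a^r(\phi,\psi)$; rules (MP) from $\phi$ and $\phi\to\psi$ infer $\psi$; (NK) from $\vdash\phi$ infer $\vdash K_a\phi$; (NKyR)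 from $\phi\in\Lambda$ infer $\vdash Ky_a^r(\top,\phi)$. -}

module Defs where

open import Data.Nat using (ℕ)
open import Data.Bool using (Bool; true; not; _∧_)
open import Relation.Binary.PropositionalEquality using (_≡_)

data Form (Ag : Set) : Set where
  atom : ℕ → Form Ag
  ¬'_  : Form Ag → Form Ag
  _∧'_ : Form Ag → Form Ag → Form Ag
  K    : Ag → Form Ag → Form Ag
  Ky   : Ag → Form Ag → Form Ag → Form Ag

module _ {Ag : Set} where
  infixr 5 _⇒_
  _⇒_ : Form Ag → Form Ag → Form Ag
  φ ⇒ ψ = ¬' (φ ∧' (¬' ψ))

  ⊤' : Form Ag
  ⊤' = atom 0 ⇒ atom 0

  -- Propositional evaluation: atoms and modal formulas K_a φ, Ky_a^r(φ,ψ)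
  -- are treated as propositional letters with truth value given by v.
  eval : (Form Ag → Bool) → Form Ag → Bool
  eval v (atom p) = v (atom p)
  eval v (¬' φ) = not (eval v φ)
  eval v (φ ∧' ψ) = eval v φ ∧ eval v ψ
  eval v (K a φ) = v (K a φ)
  eval v (Ky a φ ψ) = v (Ky a φ ψ)

  Taut : Form Ag → Set
  Taut φ = ∀ (v : Form Ag → Bool) → eval v φ ≡ true

  data SKYR (Λ : Form Ag → Set) : Form Ag → Set where
    PT   : ∀ {φ} → Taut φ → SKYR Λ φ
    Kax  : ∀ a φ ψ → SKYR Λ (K a (φ ⇒ ψ) ⇒ (K a φ ⇒ K a ψ))
    Tax  : ∀ a φ → SKYR Λ (K a φ ⇒ φ)
    4ax  : ∀ a φ → SKYR Λ (K a φ ⇒ K a (K a φ))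
    5ax  : ∀ a φ → SKYR Λ (¬' (K a φ) ⇒ K a (¬' (K a φ)))
    EKyR : ∀ a χ θ φ ψ →
           SKYR Λ (Ky a χ (φ ⇒ ψ) ⇒ (Ky a θ φ ⇒ Ky a (χ ∧' θ) ψ))
    4YKR : ∀ a φ ψ → SKYR Λ (Ky a φ ψ ⇒ K a (Ky a φ ψ))
    DKyR : ∀ a φ ψ → SKYR Λ (Ky a φ ψ ⇒ K a (φ ⇒ ψ))
    IKyR : ∀ a φ ψ χ → SKYR Λ (Ky a ψ χ ⇒ (K a (φ ⇒ ψ) ⇒ Ky a φ χ))
    UKyR : ∀ a φ ψ → SKYR Λ (K a (¬' φ) ⇒ Ky a φ ψ)
    MP   : ∀ {φ ψ} → SKYR Λ φ → SKYR Λ (φ ⇒ ψ) → SKYR Λ ψ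
    NK   : ∀ a {φ} → SKYR Λ φ → SKYR Λ (K a φ)
    NKyR : ∀ a {φ} → Λ φ → SKYR Λ (Ky a ⊤' φ)

module Submission where

-- Proof idea.  Λ-members are known by a under the trivial condition ⊤
-- (rule NKyR), and every condition ψ trivially implies ⊤.  Axiom IKyR says
-- that conditional knowledge is preserved when the condition is strengthened
-- along a known implication, so Ky_a(⊤,φ) yields Ky_a(ψ,φ).

open import Defs
open import Data.Bool using (Bool; true; false; not; _∧_)
open import Relation.Binary.PropositionalEquality using (_≡_; refl)

strengthen-condition : {Ag : Set} {Λ : Form Ag → Set} (a : Ag) {φ ψ χ : Form Ag} →
  SKYR Λ (φ ⇒ ψ) → SKYR Λ (Ky a ψ χ) → SKYR Λ (Ky a φ χ)
strengthen-condition a {φ} {ψ} {χ} φ⇒ψ kyψχ =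
  MP (NK a φ⇒ψ) (MP kyψχ (IKyR a φ ψ χ))

implies-⊤-taut : {Ag : Set} (ψ : Form Ag) → Taut (ψ ⇒ ⊤')
implies-⊤-taut ψ v = truth-table (eval v ψ) (v (atom 0))
  where
  truth-table : (x y : Bool) → not (x ∧ not (not (y ∧ not y))) ≡ true
  truth-table false _     = refl
  truth-table true  false = refl
  truth-table true  true  = refl

lemma3p9 : {Ag : Set} (Λ : Form Ag → Set) (a : Ag) (φ ψ : Form Ag) →
    Λ φ → SKYR Λ (Ky a ψ φ)
lemma3p9 Λ a φ ψ φ∈Λ =
  strengthen-condition a (PT (implies-⊤-taut ψ)) (NKyR a φ∈Λ)
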